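{- Let $l$ be a positive integer and $U=U(P,Q)$ a $\Delta$-regular Lucas sequence. If there exists a prime $p>l$ with $p\nmid Q$ and $\rho_U(p)=l$, then for every integer $j\geq0$ the number $C_{U,l}(lp^j-1)$ is not an integer, where \[ C_{U,l}(n)=\frac{1}{U_{n+1}^l}\cdot\frac{((l+1)n)!_U}{(n!_U)^{l+1}}. \]
   Context: For nonzero integers $P,Q$, $U=U(P,Q)$: $U_0=0$, $U_1=1$, $U_{n+2}=PU_{n+1}-QU_n$; $\Delta=P^2-4Q$. $U$ is $\Delta$-regular if $U_n\neq0$ for all $n\geq1$, $\gcd(P,Q)=1$, $\Delta\neq0$. $\rho_U(p)$ is the least $n\geq1$ with $p\mid U_n$. $n!_U=U_n\cdots U_1$, $0!_U=1$. -}

module Defs where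

open import Data.Nat as ℕ using (ℕ; zero; suc)
open import Data.Integer using (ℤ; +_; _+_; _-_; _*_; _^_; ∣_∣)
open import Data.Integer.Divisibility using (_∣_)
open import Data.Nat.GCD using (gcd)
open import Data.Product using (_×_)
open import Relation.Binary.PropositionalEquality using (_≡_; _≢_)
open import Relation.Nullary using (¬_)

U : ℤ → ℤ → ℕ → ℤ
U P Q zero = + 0
U P Q (suc zero) = + 1
U P Q (suc (suc n)) = P * U P Q (suc n) - Q * U P Q n

Δ : ℤ → ℤ → ℤ
Δ P Q = P * P - (+ 4) * Q

Regular : ℤ → ℤ → Set
Regular P Q =
  P ≢ + 0 × Q ≢ + 0 ×
  (∀ (n : ℕ) → 1 ℕ.≤ n → U P Q n ≢ + 0) ×
  gcd ∣ P ∣ ∣ Q ∣ ≡ 1 ×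
  Δ P Q ≢ + 0

RankIs : ℤ → ℤ → ℕ → ℕ → Set
RankIs P Q p l =
  1 ℕ.≤ l × (+ p) ∣ U P Q l ×
  (∀ (m : ℕ) → 1 ℕ.≤ m → m ℕ.< l → ¬ ((+ p) ∣ U P Q m))

fact : ℤ → ℤ → ℕ → ℤ
fact P Q zero = + 1
fact P Q (suc n) = U P Q (suc n) * fact P Q n

-- Write ν for the p-adic valuation, L = l pʲ and n = L - 1. Since p ∤ Q, no two
-- consecutive terms of U are divisible by p, and the congruence
-- U_{L+1} U_{kL} ≡ k U_{L+1}ᵏ U_L (mod U_L²) gives ν(U_{kL}) = ν(U_L) for p ∤ k and
-- ν(U_{pL}) > ν(U_L). Starting from the rank l, induction on j shows that U_L is a
-- strict peak: ν(U_r) < ν(U_L) for 0 < r < L. The addition formula then gives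
-- ν(U_{r+iL}) = ν(U_r) for 0 < r < L and i < p, so ((l+1)L - 1)!_U has valuation
-- l (ν(n!_U) + ν(U_L)) + ν(n!_U), exactly that of the denominator U_Lˡ (n!_U)^{l+1}.
-- But ((l+1)L - 1)!_U is a multiple of ((l+1)n + 1)!_U, and l ∣ (l+1)n + 1 makes
-- p ∣ U_{(l+1)n+1}; hence ((l+1)n)!_U has strictly smaller valuation than the
-- denominator.

module Submission where

open import Defs
open import Data.Nat as ℕ using (ℕ; suc; _∸_)
open import Data.Nat.Primality using (Prime)
open import Data.Integer using (ℤ; +_; _*_; _^_)
open import Data.Integer.Divisibility using (_∣_)
open import Relation.Nullary using (¬_)

open import Data.Nat.Base using (zero; NonZero; z≤n; s≤s; ≢-nonZero)
open import Data.Nat.Primality using (euclidsLemma; prime⇒nonZero; prime⇒nonTrivial; ¬prime[1])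
import Data.Nat.Properties as ℕₚ
import Data.Nat.Divisibility as ℕᵈ
open import Data.Nat.Divisibility using (divides; _∣?_)
open import Data.Nat.DivMod using (_/_; _%_; m≡m%n+[m/n]*n; m%n<n; m<n*o⇒m/o<n)
import Data.Integer as ℤ
open import Data.Integer using (_+_; _-_)
import Data.Integer.Properties as ℤₚ
import Data.Integer.Divisibility.Signed as ℤˢ
open import Data.Product using (_×_; _,_; proj₁; proj₂; ∃; ∃₂)
open import Data.Sum using (_⊎_; inj₁; inj₂; [_,_]′)
open import Relation.Nullary using (yes; no; contradiction)
open import Relation.Binary.PropositionalEquality
open import Function using (_∘_; id)
open import Algebra.Properties.CommutativeSemigroup ℕₚ.+-commutativeSemigroup using (x∙yz≈y∙xz)
open import Data.Integer.Tactic.RingSolver using (solve-∀)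
open import Data.Nat.Tactic.RingSolver using () renaming (solve-∀ to ℕ-solve-∀)

∣m∣n⇒∣m+n : ∀ {d x y} → (+ d) ∣ x → (+ d) ∣ y → (+ d) ∣ x + y
∣m∣n⇒∣m+n {d} {x} {y} d∣x d∣y =
  ℤˢ.∣⇒∣ᵤ (ℤˢ.∣m∣n⇒∣m+n (ℤˢ.∣ᵤ⇒∣ {+ d} {x} d∣x) (ℤˢ.∣ᵤ⇒∣ {+ d} {y} d∣y))

∣m∣n⇒∣m-n : ∀ {d x y} → (+ d) ∣ x → (+ d) ∣ y → (+ d) ∣ x - y
∣m∣n⇒∣m-n {d} {x} {y} d∣x d∣y =
  ℤˢ.∣⇒∣ᵤ (ℤˢ.∣m∣n⇒∣m-n (ℤˢ.∣ᵤ⇒∣ {+ d} {x} d∣x) (ℤˢ.∣ᵤ⇒∣ {+ d} {y} d∣y))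

∣m+n∣n⇒∣m : ∀ {d x y} → (+ d) ∣ x + y → (+ d) ∣ y → (+ d) ∣ x
∣m+n∣n⇒∣m {d} {x} {y} d∣x+y d∣y =
  ℤˢ.∣⇒∣ᵤ (ℤˢ.∣m+n∣n⇒∣m {m = x} (ℤˢ.∣ᵤ⇒∣ {+ d} {x + y} d∣x+y) (ℤˢ.∣ᵤ⇒∣ {+ d} {y} d∣y))

∣n⇒∣m*n : ∀ {d} x y → (+ d) ∣ y → (+ d) ∣ x * y
∣n⇒∣m*n {d} x y d∣y = subst (ℕᵈ._∣_ d) (sym (ℤₚ.abs-* x y)) (ℕᵈ.∣n⇒∣m*n ℤ.∣ x ∣ d∣y)

∣m⇒∣m*n : ∀ {d} x y → (+ d) ∣ x → (+ d) ∣ x * y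
∣m⇒∣m*n {d} x y d∣x = subst (ℕᵈ._∣_ d) (sym (ℤₚ.abs-* x y)) (ℕᵈ.∣m⇒∣m*n ℤ.∣ y ∣ d∣x)

*-≢0 : ∀ {x y} → x ≢ + 0 → y ≢ + 0 → x * y ≢ + 0
*-≢0 {x} x≢0 y≢0 xy≡0 with ℤₚ.i*j≡0⇒i≡0∨j≡0 x xy≡0
... | inj₁ x≡0 = x≢0 x≡0
... | inj₂ y≡0 = y≢0 y≡0

module Valuation (p : ℕ) (p-prime : Prime p) where

  instance
    p≢0 : NonZero p
    p≢0 = prime⇒nonZero p-prime

  infix 8 p^_
  p^_ : ℕ → ℤ
  p^ e = + (p ℕ.^ e)

  p^-mono-∣ : ∀ {a b} → a ℕ.≤ b → p ℕ.^ a ℕᵈ.∣ p ℕ.^ b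
  p^-mono-∣ {a} {b} a≤b = divides (p ℕ.^ (b ∸ a)) (begin
    p ℕ.^ b                     ≡⟨ cong (p ℕ.^_) (ℕₚ.m+[n∸m]≡n a≤b) ⟨
    p ℕ.^ (a ℕ.+ (b ∸ a))       ≡⟨ ℕₚ.^-distribˡ-+-* p a (b ∸ a) ⟩
    p ℕ.^ a ℕ.* p ℕ.^ (b ∸ a)   ≡⟨ ℕₚ.*-comm (p ℕ.^ a) _ ⟩
    p ℕ.^ (b ∸ a) ℕ.* p ℕ.^ a   ∎)
    where open ≡-Reasoning

  p∤1 : ¬ p ℕᵈ.∣ 1
  p∤1 p∣1 = ¬prime[1] (subst Prime (ℕᵈ.∣1⇒≡1 p∣1) p-prime)

  ∤⇒≢0 : ∀ x → ¬ (+ p) ∣ x → x ≢ + 0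
  ∤⇒≢0 _ p∤x refl = p∤x (p ℕᵈ.∣0)

  euclidsLemmaℤ : ∀ x y → (+ p) ∣ x * y → (+ p) ∣ x ⊎ (+ p) ∣ y
  euclidsLemmaℤ x y p∣xy =
    euclidsLemma ℤ.∣ x ∣ ℤ.∣ y ∣ p-prime (subst (ℕᵈ._∣_ p) (ℤₚ.abs-* x y) p∣xy)

  -- For n ≢ 0, count k n is the exponent of p in n as soon as the fuel k is at least n;
  -- ν 0 = 0 is a junk value.
  private
    count : ℕ → ℕ → ℕ
    count zero    n = 0
    count (suc k) n with p ∣? n
    ... | yes (divides q _) = suc (count k q)
    ... | no _              = 0

    count-exact : ∀ k n → n ≢ 0 → n ℕ.≤ k →
      p ℕ.^ count k n ℕᵈ.∣ n × ¬ p ℕ.^ suc (count k n) ℕᵈ.∣ n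
    count-exact zero    n n≢0 n≤0 = contradiction (ℕₚ.n≤0⇒n≡0 n≤0) n≢0
    count-exact (suc k) n n≢0 n≤k with p ∣? n
    ... | no p∤n = ℕᵈ.1∣ n , λ p^1∣n → p∤n (subst (ℕᵈ._∣ n) (ℕₚ.*-identityʳ p) p^1∣n)
    ... | yes (divides q refl) = p^c∣n , p^c+1∤n
      where
      q≢0 : q ≢ 0
      q≢0 refl = n≢0 refl
      q≤k : q ℕ.≤ k
      q≤k = ℕₚ.<⇒≤pred (ℕₚ.<-≤-trans (ℕₚ.m<m*n q p {{≢-nonZero q≢0}}
              (ℕ.nonTrivial⇒n>1 p {{prime⇒nonTrivial p-prime}})) n≤k)
      IH = count-exact k q q≢0 q≤k
      p^c∣n : p ℕ.* p ℕ.^ count k q ℕᵈ.∣ q ℕ.* p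
      p^c∣n = subst (ℕᵈ._∣ q ℕ.* p) (ℕₚ.*-comm (p ℕ.^ count k q) p)
                (ℕᵈ.*-monoˡ-∣ p (proj₁ IH))
      p^c+1∤n : ¬ p ℕ.* (p ℕ.* p ℕ.^ count k q) ℕᵈ.∣ q ℕ.* p
      p^c+1∤n h = proj₂ IH (ℕᵈ.*-cancelʳ-∣ p
        (subst (ℕᵈ._∣ q ℕ.* p) (ℕₚ.*-comm p (p ℕ.* p ℕ.^ count k q)) h))

  ν : ℤ → ℕ
  ν x = count ℤ.∣ x ∣ ℤ.∣ x ∣

  ν-exact : ∀ {x} → x ≢ + 0 → p^ ν x ∣ x × ¬ p^ suc (ν x) ∣ x
  ν-exact {x} x≢0 = count-exact ℤ.∣ x ∣ ℤ.∣ x ∣ (x≢0 ∘ ℤₚ.∣i∣≡0⇒i≡0) ℕₚ.≤-refl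

  p^ν∣ : ∀ x → p^ ν x ∣ x
  p^ν∣ x with x ℤ.≟ + 0
  ... | yes refl = _ ℕᵈ.∣0
  ... | no x≢0   = proj₁ (ν-exact x≢0)

  ≤ν : ∀ {x m} → x ≢ + 0 → p^ m ∣ x → m ℕ.≤ ν x
  ≤ν {x} {m} x≢0 p^m∣x with m ℕ.≤? ν x
  ... | yes m≤ν = m≤ν
  ... | no  m≰ν = contradiction (ℕᵈ.∣-trans (p^-mono-∣ (ℕₚ.≰⇒> m≰ν)) p^m∣x) (proj₂ (ν-exact x≢0))

  ν-unique : ∀ {x e} → p^ e ∣ x → ¬ p^ suc e ∣ x → ν x ≡ e
  ν-unique {x} {e} p^e∣x p^1+e∤x = ℕₚ.≤-antisym ν≤e (≤ν x≢0 p^e∣x)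
    where
    x≢0 : x ≢ + 0
    x≢0 refl = p^1+e∤x (_ ℕᵈ.∣0)
    ν≤e : ν x ℕ.≤ e
    ν≤e with ν x ℕ.≤? e
    ... | yes ν≤e = ν≤e
    ... | no  ν≰e = contradiction (ℕᵈ.∣-trans (p^-mono-∣ (ℕₚ.≰⇒> ν≰e)) (p^ν∣ x)) p^1+e∤x

  p∣⇒p^1∣ : ∀ x → (+ p) ∣ x → p^ 1 ∣ x
  p∣⇒p^1∣ _ = subst (ℕᵈ._∣ _) (sym (ℕₚ.*-identityʳ p))

  p^[1+e]∣⇒p∣ : ∀ e x → p^ suc e ∣ x → (+ p) ∣ x
  p^[1+e]∣⇒p∣ e _ = ℕᵈ.∣-trans (ℕᵈ.m∣m*n (p ℕ.^ e))

  ν≡0 : ∀ x → ¬ (+ p) ∣ x → ν x ≡ 0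
  ν≡0 x p∤x = ν-unique {x} {0} (ℕᵈ.1∣ _) (p∤x ∘ subst (ℕᵈ._∣ _) (ℕₚ.*-identityʳ p))

  0<ν : ∀ {x} → x ≢ + 0 → (+ p) ∣ x → 0 ℕ.< ν x
  0<ν {x} x≢0 p∣x = ≤ν {x} {1} x≢0 (p∣⇒p^1∣ x p∣x)

  ν-cofactor : ∀ {x} → x ≢ + 0 →
    ∃ λ c → ¬ p ℕᵈ.∣ c × ℤ.∣ x ∣ ≡ c ℕ.* p ℕ.^ ν x
  ν-cofactor {x} x≢0 with p^ν∣ x
  ... | divides c ∣x∣≡c*p^ν = c , p∤c , ∣x∣≡c*p^ν
    where
    p∤c : ¬ p ℕᵈ.∣ c
    p∤c (divides t refl) = proj₂ (ν-exact x≢0)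
      (divides t (trans ∣x∣≡c*p^ν (ℕₚ.*-assoc t p (p ℕ.^ ν x))))

  ν-* : ∀ {x y} → x ≢ + 0 → y ≢ + 0 → ν (x * y) ≡ ν x ℕ.+ ν y
  ν-* {x} {y} x≢0 y≢0 with ν-cofactor x≢0 | ν-cofactor y≢0
  ... | c , p∤c , ∣x∣≡ | d , p∤d , ∣y∣≡ =
    ν-unique {x * y} {a ℕ.+ b} (divides (c ℕ.* d) ∣xy∣≡) p^1+a+b∤xy
    where
    a = ν x
    b = ν y
    ∣xy∣≡ : ℤ.∣ x * y ∣ ≡ c ℕ.* d ℕ.* p ℕ.^ (a ℕ.+ b)
    ∣xy∣≡ = begin
      ℤ.∣ x * y ∣                           ≡⟨ ℤₚ.abs-* x y ⟩
      ℤ.∣ x ∣ ℕ.* ℤ.∣ y ∣                    ≡⟨ cong₂ ℕ._*_ ∣x∣≡ ∣y∣≡ ⟩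
      c ℕ.* p ℕ.^ a ℕ.* (d ℕ.* p ℕ.^ b)     ≡⟨ regroup c d (p ℕ.^ a) (p ℕ.^ b) ⟩
      c ℕ.* d ℕ.* (p ℕ.^ a ℕ.* p ℕ.^ b)     ≡⟨ cong (c ℕ.* d ℕ.*_) (ℕₚ.^-distribˡ-+-* p a b) ⟨
      c ℕ.* d ℕ.* p ℕ.^ (a ℕ.+ b)           ∎
      where
      open ≡-Reasoning
      regroup : ∀ c d x y → c ℕ.* x ℕ.* (d ℕ.* y) ≡ c ℕ.* d ℕ.* (x ℕ.* y)
      regroup = ℕ-solve-∀
    p^1+a+b∤xy : ¬ p^ suc (a ℕ.+ b) ∣ x * y
    p^1+a+b∤xy h = [ p∤c , p∤d ]′ (euclidsLemma c d p-prime
      (ℕᵈ.*-cancelʳ-∣ (p ℕ.^ (a ℕ.+ b)) {{ℕₚ.m^n≢0 p (a ℕ.+ b)}} (subst (ℕᵈ._∣_ _) ∣xy∣≡ h)))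

  ^-≢0 : ∀ {x} k → x ≢ + 0 → x ^ k ≢ + 0
  ^-≢0 zero    x≢0 ()
  ^-≢0 (suc k) x≢0 = *-≢0 x≢0 (^-≢0 k x≢0)

  ν-^ : ∀ {x} k → x ≢ + 0 → ν (x ^ k) ≡ k ℕ.* ν x
  ν-^ zero    x≢0 = ν≡0 (+ 1) p∤1
  ν-^ {x} (suc k) x≢0 = begin
    ν (x * x ^ k)         ≡⟨ ν-* x≢0 (^-≢0 k x≢0) ⟩
    ν x ℕ.+ ν (x ^ k)     ≡⟨ cong (ν x ℕ.+_) (ν-^ k x≢0) ⟩
    ν x ℕ.+ k ℕ.* ν x     ∎
    where open ≡-Reasoning

  ν-+ : ∀ x y → x ≢ + 0 → p^ suc (ν x) ∣ y → ν (x + y) ≡ ν x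
  ν-+ x y x≢0 p^1+ν∣y = ν-unique {x + y} {ν x}
    (∣m∣n⇒∣m+n {p ℕ.^ ν x} {x} {y} (p^ν∣ x) (ℕᵈ.∣-trans (p^-mono-∣ (ℕₚ.n≤1+n (ν x))) p^1+ν∣y))
    (λ h → proj₂ (ν-exact x≢0) (∣m+n∣n⇒∣m {p ℕ.^ suc (ν x)} {x} {y} h p^1+ν∣y))

module Lucas (P Q : ℤ) where

  u : ℕ → ℤ
  u = U P Q

  u! : ℕ → ℤ
  u! = fact P Q

  m≤n⇒u!∣u! : ∀ {m n} → m ℕ.≤ n → u! m ∣ u! n
  m≤n⇒u!∣u! m≤n = go (ℕₚ.≤⇒≤′ m≤n)
    where
    go : ∀ {m n} → m ℕ.≤′ n → u! m ∣ u! n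
    go ℕ.≤′-refl = ℕᵈ.∣-refl
    go {n = suc n} (ℕ.≤′-step m≤′n) =
      subst (ℕᵈ._∣_ _) (sym (ℤₚ.abs-* (u (suc n)) (u! n))) (ℕᵈ.∣n⇒∣m*n ℤ.∣ u (suc n) ∣ (go m≤′n))

  U-+ : ∀ m n → u (m ℕ.+ n) ≡ u (suc m) * u n + u m * (u (suc n) - P * u n)
  U-+ zero          n = base₀ (u n) (u (suc n) - P * u n)
    where
    base₀ : ∀ x d → x ≡ + 1 * x + + 0 * d
    base₀ = solve-∀
  U-+ (suc zero)    n = base₁ P Q (u n) (u (suc n))
    where
    base₁ : ∀ P Q x y → y ≡ (P * + 1 - Q * + 0) * x + + 1 * (y - P * x)
    base₁ = solve-∀
  U-+ (suc (suc m)) n rewrite U-+ (suc m) n | U-+ m n =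
    step P Q (u (suc (suc m))) (u (suc m)) (u m) (u n) (u (suc n) - P * u n)
    where
    step : ∀ P Q a b c x d →
      P * (a * x + b * d) - Q * (b * x + c * d) ≡ (P * a - Q * b) * x + (P * b - Q * c) * d
    step = solve-∀

  cofactor : ℕ → ℕ → ℤ → ℤ
  cofactor L k β = + k * u (suc L) ^ k + u L * β

  U[k*L]-expansion : ∀ L k → ∃₂ λ α β →
      u (suc (k ℕ.* L)) ≡ u (suc L) ^ k + u L * α
    × u (suc L) * u (k ℕ.* L) ≡ u L * cofactor L k β
  U[k*L]-expansion L zero = + 0 , + 0 , base₁ (u L) , base₂ (u (suc L)) (u L)
    where
    base₁ : ∀ x → + 1 ≡ + 1 + x * + 0
    base₁ = solve-∀
    base₂ : ∀ c x → c * + 0 ≡ x * (+ 0 * + 1 + x * + 0)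
    base₂ = solve-∀
  U[k*L]-expansion L (suc k) with U[k*L]-expansion L k
  ... | α , β , A≡ , cB≡ = α′ , β′ , A′≡ , cB′≡
    where
    open ≡-Reasoning
    c = u (suc L)
    x = u L
    A = u (suc (k ℕ.* L))
    B = u (k ℕ.* L)
    α′ = α * c - Q * B
    β′ = c * α - P * + k * c ^ k + (c - P * x) * β

    A′≡ : u (suc (L ℕ.+ k ℕ.* L)) ≡ c * c ^ k + x * α′
    A′≡ = begin
      u (suc (L ℕ.+ k ℕ.* L))
        ≡⟨ cong u (trans (cong suc (ℕₚ.+-comm L (k ℕ.* L))) (sym (ℕₚ.+-suc (k ℕ.* L) L))) ⟩
      u (k ℕ.* L ℕ.+ suc L)
        ≡⟨ U-+ (k ℕ.* L) (suc L) ⟩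
      A * c + B * ((P * c - Q * x) - P * c)
        ≡⟨ cong (λ A → A * c + B * ((P * c - Q * x) - P * c)) A≡ ⟩
      (c ^ k + x * α) * c + B * ((P * c - Q * x) - P * c)
        ≡⟨ ring P Q c x α B (c ^ k) ⟩
      c * c ^ k + x * α′ ∎
      where
      ring : ∀ P Q c x α B cᵏ →
        (cᵏ + x * α) * c + B * ((P * c - Q * x) - P * c) ≡ c * cᵏ + x * (α * c - Q * B)
      ring = solve-∀

    cB′≡ : c * u (L ℕ.+ k ℕ.* L) ≡ x * cofactor L (suc k) β′
    cB′≡ = begin
      c * u (L ℕ.+ k ℕ.* L)
        ≡⟨ cong (λ n → c * u n) (ℕₚ.+-comm L (k ℕ.* L)) ⟩
      c * u (k ℕ.* L ℕ.+ L)
        ≡⟨ cong (c *_) (U-+ (k ℕ.* L) L) ⟩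
      c * (A * x + B * (c - P * x))
        ≡⟨ distrib c A x B (c - P * x) ⟩
      c * A * x + c * B * (c - P * x)
        ≡⟨ cong₂ (λ A cB → c * A * x + cB * (c - P * x)) A≡ cB≡ ⟩
      c * (c ^ k + x * α) * x + x * (+ k * c ^ k + x * β) * (c - P * x)
        ≡⟨ ring P c x α β (+ k) (c ^ k) ⟩
      x * ((+ 1 + + k) * (c * c ^ k) + x * β′) ∎
      where
      distrib : ∀ c A x B d → c * (A * x + B * d) ≡ c * A * x + c * B * d
      distrib = solve-∀
      ring : ∀ P c x α β K cᵏ →
        c * (cᵏ + x * α) * x + x * (K * cᵏ + x * β) * (c - P * x)
          ≡ x * ((+ 1 + K) * (c * cᵏ) + x * (c * α - P * K * cᵏ + (c - P * x) * β))
      ring = solve-∀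

module LucasValuation (P Q : ℤ) (p : ℕ) (p-prime : Prime p) (p∤Q : ¬ (+ p) ∣ Q)
  (U≢0 : ∀ n .{{_ : NonZero n}} → U P Q n ≢ + 0) where

  open Lucas P Q
  open Valuation p p-prime

  p∤U-consecutive : ∀ n → (+ p) ∣ u n → ¬ (+ p) ∣ u (suc n)
  p∤U-consecutive zero    _         p∣u₁ = p∤1 p∣u₁
  p∤U-consecutive (suc n) p∣u[1+n] p∣u[2+n] =
    [ p∤Q , (λ p∣uₙ → p∤U-consecutive n p∣uₙ p∣u[1+n]) ]′ (euclidsLemmaℤ Q (u n) p∣Q*uₙ)
    where
    cancel : ∀ P Q a b → P * a - (P * a - Q * b) ≡ Q * b
    cancel = solve-∀
    p∣Q*uₙ : (+ p) ∣ Q * u n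
    p∣Q*uₙ = subst ((+ p) ∣_) (cancel P Q (u (suc n)) (u n))
      (∣m∣n⇒∣m-n {p} {P * u (suc n)} (∣n⇒∣m*n P (u (suc n)) p∣u[1+n]) p∣u[2+n])

  p∣U[k*L] : ∀ L k → (+ p) ∣ u L → (+ p) ∣ u (k ℕ.* L)
  p∣U[k*L] L k p∣uL with U[k*L]-expansion L k
  ... | _ , β , _ , cB≡ = [ (λ p∣c → contradiction p∣c (p∤U-consecutive L p∣uL)) , id ]′
    (euclidsLemmaℤ (u (suc L)) (u (k ℕ.* L))
      (subst ((+ p) ∣_) (sym cB≡) (∣m⇒∣m*n (u L) (cofactor L k β) p∣uL)))

  ν-U[k*L]≡ : ∀ L k .{{_ : NonZero L}} .{{_ : NonZero k}} → (+ p) ∣ u L →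
    ∃ λ β → cofactor L k β ≢ + 0 × ν (u (k ℕ.* L)) ≡ ν (u L) ℕ.+ ν (cofactor L k β)
  ν-U[k*L]≡ L k p∣uL with U[k*L]-expansion L k
  ... | _ , β , _ , cB≡ = β , w≢0 , (begin
    ν B                 ≡⟨ cong (ℕ._+ ν B) (ν≡0 c p∤c) ⟨
    ν c ℕ.+ ν B         ≡⟨ ν-* c≢0 B≢0 ⟨
    ν (c * B)           ≡⟨ cong ν cB≡ ⟩
    ν (u L * w)         ≡⟨ ν-* (U≢0 L) w≢0 ⟩
    ν (u L) ℕ.+ ν w     ∎)
    where
    open ≡-Reasoning
    c = u (suc L)
    B = u (k ℕ.* L)
    w = cofactor L k β
    p∤c : ¬ (+ p) ∣ c
    p∤c = p∤U-consecutive L p∣uL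
    c≢0 : c ≢ + 0
    c≢0 = ∤⇒≢0 c p∤c
    B≢0 : B ≢ + 0
    B≢0 = U≢0 (k ℕ.* L) {{ℕₚ.m*n≢0 k L}}
    w≢0 : w ≢ + 0
    w≢0 w≡0 = *-≢0 c≢0 B≢0 (trans cB≡ (trans (cong (u L *_) w≡0) (ℤₚ.*-zeroʳ (u L))))

  ν-U[k*L] : ∀ L k .{{_ : NonZero L}} .{{_ : NonZero k}} → (+ p) ∣ u L → ¬ p ℕᵈ.∣ k →
    ν (u (k ℕ.* L)) ≡ ν (u L)
  ν-U[k*L] L k p∣uL p∤k with ν-U[k*L]≡ L k p∣uL
  ... | β , _ , ν≡ = trans ν≡ (trans (cong (ν (u L) ℕ.+_) νw≡0) (ℕₚ.+-identityʳ _))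
    where
    open ≡-Reasoning
    c = u (suc L)
    p∤c : ¬ (+ p) ∣ c
    p∤c = p∤U-consecutive L p∣uL
    c≢0 : c ≢ + 0
    c≢0 = ∤⇒≢0 c p∤c
    k≢0 : + k ≢ + 0
    k≢0 = ∤⇒≢0 (+ k) p∤k
    ν[k*cᵏ]≡0 : ν (+ k * c ^ k) ≡ 0
    ν[k*cᵏ]≡0 = begin
      ν (+ k * c ^ k)             ≡⟨ ν-* k≢0 (^-≢0 k c≢0) ⟩
      ν (+ k) ℕ.+ ν (c ^ k)       ≡⟨ cong₂ ℕ._+_ (ν≡0 (+ k) p∤k) (ν-^ k c≢0) ⟩
      k ℕ.* ν c                   ≡⟨ cong (k ℕ.*_) (ν≡0 c p∤c) ⟩
      k ℕ.* 0                     ≡⟨ ℕₚ.*-zeroʳ k ⟩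
      0                           ∎
    νw≡0 : ν (cofactor L k β) ≡ 0
    νw≡0 = trans (ν-+ (+ k * c ^ k) (u L * β) (*-≢0 k≢0 (^-≢0 k c≢0))
                   (subst (λ e → p^ suc e ∣ u L * β) (sym ν[k*cᵏ]≡0)
                     (∣m⇒∣m*n (u L) β (p∣⇒p^1∣ (u L) p∣uL))))
                 ν[k*cᵏ]≡0

  ν-U[p*L] : ∀ L .{{_ : NonZero L}} → (+ p) ∣ u L → ν (u L) ℕ.< ν (u (p ℕ.* L))
  ν-U[p*L] L p∣uL with ν-U[k*L]≡ L p p∣uL
  ... | β , w≢0 , ν≡ = subst (ν (u L) ℕ.<_) (sym ν≡) (ℕₚ.m<m+n (ν (u L)) (0<ν w≢0 p∣w))
    where
    p∣w : (+ p) ∣ cofactor L p β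
    p∣w = ∣m∣n⇒∣m+n {p} {+ p * u (suc L) ^ p}
      (∣m⇒∣m*n (+ p) (u (suc L) ^ p) ℕᵈ.∣-refl) (∣m⇒∣m*n (u L) β p∣uL)

  ν-U-shift : ∀ M r → u r ≢ + 0 → p^ suc (ν (u r)) ∣ u M → ν (u (r ℕ.+ M)) ≡ ν (u r)
  ν-U-shift M r u≢0 p^1+ν∣uM = begin
    ν (u (r ℕ.+ M))                 ≡⟨ cong (ν ∘ u) (ℕₚ.+-comm r M) ⟩
    ν (u (M ℕ.+ r))                 ≡⟨ cong ν (U-+ M r) ⟩
    ν (u (suc M) * u r + u M * d)   ≡⟨ ν-+ (u (suc M) * u r) (u M * d) (*-≢0 u[1+M]≢0 u≢0) p^1+ν∣u[M]d ⟩
    ν (u (suc M) * u r)             ≡⟨ ν[u[1+M]*u]≡ ⟩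
    ν (u r)                         ∎
    where
    open ≡-Reasoning
    d = u (suc r) - P * u r
    p∤u[1+M] : ¬ (+ p) ∣ u (suc M)
    p∤u[1+M] = p∤U-consecutive M (p^[1+e]∣⇒p∣ (ν (u r)) (u M) p^1+ν∣uM)
    u[1+M]≢0 : u (suc M) ≢ + 0
    u[1+M]≢0 = ∤⇒≢0 (u (suc M)) p∤u[1+M]
    ν[u[1+M]*u]≡ : ν (u (suc M) * u r) ≡ ν (u r)
    ν[u[1+M]*u]≡ = trans (ν-* u[1+M]≢0 u≢0) (cong (ℕ._+ ν (u r)) (ν≡0 (u (suc M)) p∤u[1+M]))
    p^1+ν∣u[M]d : p^ suc (ν (u (suc M) * u r)) ∣ u M * d
    p^1+ν∣u[M]d = subst (λ e → p^ suc e ∣ u M * d) (sym ν[u[1+M]*u]≡) (∣m⇒∣m*n (u M) d p^1+ν∣uM)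

  u!≢0 : ∀ n → u! n ≢ + 0
  u!≢0 zero    ()
  u!≢0 (suc n) = *-≢0 (U≢0 (suc n)) (u!≢0 n)

  ν-U[r+q*L] : ∀ r q L .{{_ : NonZero r}} .{{_ : NonZero L}} →
    (+ p) ∣ u L → q ℕ.< p → ν (u r) ℕ.< ν (u L) → ν (u (r ℕ.+ q ℕ.* L)) ≡ ν (u r)
  ν-U[r+q*L] r zero    L _    _   _             = cong (ν ∘ u) (ℕₚ.+-identityʳ r)
  ν-U[r+q*L] r (suc q) L p∣uL q<p ν[ur]<ν[uL] = ν-U-shift (suc q ℕ.* L) r (U≢0 r)
    (ℕᵈ.∣-trans (p^-mono-∣ ν[ur]<ν[uL])
      (subst (λ e → p^ e ∣ u (suc q ℕ.* L)) (ν-U[k*L] L (suc q) p∣uL (ℕᵈ.>⇒∤ q<p))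
        (p^ν∣ (u (suc q ℕ.* L)))))

  Peak : ℕ → Set
  Peak L = ∀ r → 1 ℕ.≤ r → r ℕ.< L → ν (u r) ℕ.< ν (u L)

  Peak-step : ∀ L .{{_ : NonZero L}} → (+ p) ∣ u L → Peak L → Peak (p ℕ.* L)
  Peak-step L p∣uL peak r 1≤r r<pL = ℕₚ.≤-<-trans
    (subst (λ r → ν (u r) ℕ.≤ ν (u L)) (sym r≡)
      (bounded (r / L) (r % L) r/L<p (m%n<n r L) (subst (1 ℕ.≤_) r≡ 1≤r)))
    (ν-U[p*L] L p∣uL)
    where
    r≡ : r ≡ r % L ℕ.+ r / L ℕ.* L
    r≡ = m≡m%n+[m/n]*n r L
    r/L<p : r / L ℕ.< p
    r/L<p = m<n*o⇒m/o<n r<pL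
    bounded : ∀ q s → q ℕ.< p → s ℕ.< L → 1 ℕ.≤ s ℕ.+ q ℕ.* L → ν (u (s ℕ.+ q ℕ.* L)) ℕ.≤ ν (u L)
    bounded zero    zero    _   _   ()
    bounded (suc q) zero    q<p _   _ = ℕₚ.≤-reflexive (ν-U[k*L] L (suc q) p∣uL (ℕᵈ.>⇒∤ q<p))
    bounded q       (suc s) q<p s<L _ = ℕₚ.<⇒≤ (subst (ℕ._< ν (u L))
      (sym (ν-U[r+q*L] (suc s) q L p∣uL q<p ν[us]<ν[uL])) ν[us]<ν[uL])
      where
      ν[us]<ν[uL] : ν (u (suc s)) ℕ.< ν (u L)
      ν[us]<ν[uL] = peak (suc s) (s≤s z≤n) s<L

  ν-u![s+i*L] : ∀ n → (+ p) ∣ u (suc n) → Peak (suc n) → ∀ i s → i ℕ.< p → s ℕ.≤ n →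
    ν (u! (s ℕ.+ i ℕ.* suc n)) ≡ i ℕ.* (ν (u! n) ℕ.+ ν (u (suc n))) ℕ.+ ν (u! s)
  ν-u![s+i*L] n p∣uL peak = go
    where
    open ≡-Reasoning
    L = suc n
    F = ν (u! n)
    a = ν (u L)

    go : ∀ i s → i ℕ.< p → s ℕ.≤ n → ν (u! (s ℕ.+ i ℕ.* L)) ≡ i ℕ.* (F ℕ.+ a) ℕ.+ ν (u! s)
    go zero    zero    _   _   = refl
    go (suc i) zero    i<p _   = begin
      ν (u (suc i ℕ.* L) * u! (n ℕ.+ i ℕ.* L))
        ≡⟨ ν-* (U≢0 (suc i ℕ.* L)) (u!≢0 (n ℕ.+ i ℕ.* L)) ⟩
      ν (u (suc i ℕ.* L)) ℕ.+ ν (u! (n ℕ.+ i ℕ.* L))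
        ≡⟨ cong₂ ℕ._+_ (ν-U[k*L] L (suc i) p∣uL (ℕᵈ.>⇒∤ i<p)) (go i n (ℕₚ.<⇒≤ i<p) ℕₚ.≤-refl) ⟩
      a ℕ.+ (i ℕ.* (F ℕ.+ a) ℕ.+ F)
        ≡⟨ regroup i F a ⟩
      suc i ℕ.* (F ℕ.+ a) ℕ.+ 0
        ≡⟨ cong (suc i ℕ.* (F ℕ.+ a) ℕ.+_) (ν≡0 (+ 1) p∤1) ⟨
      suc i ℕ.* (F ℕ.+ a) ℕ.+ ν (u! 0) ∎
      where
      regroup : ∀ i F a → a ℕ.+ (i ℕ.* (F ℕ.+ a) ℕ.+ F) ≡ suc i ℕ.* (F ℕ.+ a) ℕ.+ 0
      regroup = ℕ-solve-∀
    go i       (suc s) i<p s<n = begin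
      ν (u (suc s ℕ.+ i ℕ.* L) * u! (s ℕ.+ i ℕ.* L))
        ≡⟨ ν-* (U≢0 (suc s ℕ.+ i ℕ.* L)) (u!≢0 (s ℕ.+ i ℕ.* L)) ⟩
      ν (u (suc s ℕ.+ i ℕ.* L)) ℕ.+ ν (u! (s ℕ.+ i ℕ.* L))
        ≡⟨ cong₂ ℕ._+_ (ν-U[r+q*L] (suc s) i L p∣uL i<p (peak (suc s) (s≤s z≤n) (s≤s s<n)))
                       (go i s i<p (ℕₚ.<⇒≤ s<n)) ⟩
      ν (u (suc s)) ℕ.+ (i ℕ.* (F ℕ.+ a) ℕ.+ ν (u! s))
        ≡⟨ x∙yz≈y∙xz (ν (u (suc s))) (i ℕ.* (F ℕ.+ a)) (ν (u! s)) ⟩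
      i ℕ.* (F ℕ.+ a) ℕ.+ (ν (u (suc s)) ℕ.+ ν (u! s))
        ≡⟨ cong (i ℕ.* (F ℕ.+ a) ℕ.+_) (ν-* (U≢0 (suc s)) (u!≢0 s)) ⟨
      i ℕ.* (F ℕ.+ a) ℕ.+ ν (u! (suc s)) ∎

  module Rank (l : ℕ) {{l≢0 : NonZero l}} (p∣u[l] : (+ p) ∣ u l)
    (minimal : ∀ m → 1 ℕ.≤ m → m ℕ.< l → ¬ (+ p) ∣ u m) (l<p : l ℕ.< p) where

    p∣u[l*p^j] : ∀ j → (+ p) ∣ u (l ℕ.* p ℕ.^ j)
    p∣u[l*p^j] j = subst (λ m → (+ p) ∣ u m) (ℕₚ.*-comm (p ℕ.^ j) l) (p∣U[k*L] l (p ℕ.^ j) p∣u[l])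

    l*p^j≢0 : ∀ j → NonZero (l ℕ.* p ℕ.^ j)
    l*p^j≢0 j = ℕₚ.m*n≢0 l (p ℕ.^ j) {{l≢0}} {{ℕₚ.m^n≢0 p j}}

    Peak-l : Peak l
    Peak-l r 1≤r r<l =
      subst (ℕ._< ν (u l)) (sym (ν≡0 (u r) (minimal r 1≤r r<l))) (0<ν (U≢0 l) p∣u[l])

    Peak-l*p^j : ∀ j → Peak (l ℕ.* p ℕ.^ j)
    Peak-l*p^j zero    = subst Peak (sym (ℕₚ.*-identityʳ l)) Peak-l
    Peak-l*p^j (suc j) = subst Peak (reassoc l p (p ℕ.^ j))
      (Peak-step (l ℕ.* p ℕ.^ j) (p∣u[l*p^j] j) (Peak-l*p^j j))
      where
      instance
        _ = l*p^j≢0 j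
      reassoc : ∀ l p q → p ℕ.* (l ℕ.* q) ≡ l ℕ.* (p ℕ.* q)
      reassoc = ℕ-solve-∀

    ¬divisible : ∀ L .{{_ : NonZero L}} → (+ p) ∣ u L → Peak L → l ℕᵈ.∣ L →
      ¬ (u (suc (L ∸ 1)) ^ l * u! (L ∸ 1) ^ suc l ∣ u! (suc l ℕ.* (L ∸ 1)))
    ¬divisible (suc n) p∣uL peak l∣L den∣u![N] = ℕₚ.<-irrefl refl (ℕₚ.<-≤-trans 1+G≤D D≤G)
      where
      L = suc n
      N = suc l ℕ.* n
      a = ν (u L)
      F = ν (u! n)
      G = ν (u! N)
      den = u L ^ l * u! n ^ suc l

      ν[den]≡ : ν den ≡ l ℕ.* a ℕ.+ suc l ℕ.* F
      ν[den]≡ = trans (ν-* (^-≢0 l (U≢0 L)) (^-≢0 (suc l) (u!≢0 n)))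
                      (cong₂ ℕ._+_ (ν-^ l (U≢0 L)) (ν-^ (suc l) (u!≢0 n)))

      D≤G : l ℕ.* a ℕ.+ suc l ℕ.* F ℕ.≤ G
      D≤G = ≤ν (u!≢0 N) (ℕᵈ.∣-trans (subst (λ e → p^ e ∣ den) ν[den]≡ (p^ν∣ den)) den∣u![N])

      l∣1+N : l ℕᵈ.∣ suc N
      l∣1+N = ℕᵈ.∣m+n∣m⇒∣n (subst (l ℕᵈ.∣_) (sym (split l n)) (ℕᵈ.∣n⇒∣m*n (suc l) l∣L)) ℕᵈ.∣-refl
        where
        split : ∀ l n → l ℕ.+ suc (suc l ℕ.* n) ≡ suc l ℕ.* suc n
        split = ℕ-solve-∀

      p∣u[1+N] : (+ p) ∣ u (suc N)
      p∣u[1+N] with l∣1+N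
      ... | divides k 1+N≡k*l = subst (λ m → (+ p) ∣ u m) (sym 1+N≡k*l) (p∣U[k*L] l k p∣u[l])

      p^[1+G]∣u![1+N] : p^ suc G ∣ u! (suc N)
      p^[1+G]∣u![1+N] = subst (ℕᵈ._∣_ _) (sym (ℤₚ.abs-* (u (suc N)) (u! N)))
                          (ℕᵈ.*-pres-∣ p∣u[1+N] (p^ν∣ (u! N)))

      1+N≤n+l*L : suc N ℕ.≤ n ℕ.+ l ℕ.* L
      1+N≤n+l*L =
        subst (suc N ℕ.≤_) (sym (split l n)) (ℕₚ.+-monoˡ-≤ (n ℕ.+ l ℕ.* n) (ℕ.>-nonZero⁻¹ l))
        where
        split : ∀ l n → n ℕ.+ l ℕ.* suc n ≡ l ℕ.+ (n ℕ.+ l ℕ.* n)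
        split = ℕ-solve-∀

      1+G≤D : suc G ℕ.≤ l ℕ.* a ℕ.+ suc l ℕ.* F
      1+G≤D = subst (suc G ℕ.≤_) (trans (ν-u![s+i*L] n p∣uL peak l n l<p ℕₚ.≤-refl) (regroup l F a))
                (≤ν (u!≢0 (n ℕ.+ l ℕ.* L)) (ℕᵈ.∣-trans p^[1+G]∣u![1+N] (m≤n⇒u!∣u! 1+N≤n+l*L)))
        where
        regroup : ∀ l F a → l ℕ.* (F ℕ.+ a) ℕ.+ F ≡ l ℕ.* a ℕ.+ suc l ℕ.* F
        regroup = ℕ-solve-∀

lemma20 : (l : ℕ) → 1 ℕ.≤ l → (P Q : ℤ) → Regular P Q →
    (p : ℕ) → Prime p → l ℕ.< p → ¬ ((+ p) ∣ Q) → RankIs P Q p l →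
    (j : ℕ) →
      ¬ ((U P Q (suc (l ℕ.* p ℕ.^ j ∸ 1)) ^ l) * (fact P Q (l ℕ.* p ℕ.^ j ∸ 1) ^ suc l)
         ∣ fact P Q (suc l ℕ.* (l ℕ.* p ℕ.^ j ∸ 1)))
lemma20 l 1≤l P Q (_ , _ , U≢0 , _ , _) p p-prime l<p p∤Q (_ , p∣u[l] , minimal) j =
  ¬divisible (l ℕ.* p ℕ.^ j) {{l*p^j≢0 j}} (p∣u[l*p^j] j) (Peak-l*p^j j) (ℕᵈ.m∣m*n (p ℕ.^ j))
  where
  open LucasValuation P Q p p-prime p∤Q (λ n → U≢0 n (ℕ.>-nonZero⁻¹ n))
  open Rank l {{ℕ.>-nonZero 1≤l}} p∣u[l] minimal l<p
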